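{- Let $\mathcal D=(\mathcal P,\mathcal B,\mathcal I)$ be a quasi-symmetric $(v,b,r,k,\lambda_1,0)$ SPBIBD of type $(k-1,t)$ with intersection numbers $x=0$ and $y>0$. Then for every $B\in\mathcal B$ there exist $B_1,B_2\in\mathcal B$ such that $|B\cap B_1|=0$ and $|B\cap B_2|=y$.
   Context: An incidence structure $\mathcal D=(\mathcal P,\mathcal B,\mathcal I)$ has finite point set $\mathcal P$, block set $\mathcal B$, incidence $\mathcal I\subseteq\mathcal P\times\mathcal B$ (write $p\in B$; $B\cap B'$ denotes the set of points incident with both). $(p,B)$ is a flag if $p\in B$, a non-flag otherwise. A $(v,b,r,k,\lambda_1,\lambda_2)$ SPBIBD of type $(s,t)$: $|\mathcal P|=v$, $|\mathcal B|=b$, each block has $k$ points, each point lies in $r$ blocks; any two distinct points lie together in exactly $\lambda_1$ or exactly $\lambda_2$ blocks; for every flag $(p,B)$ exactly $s$ points of $B$ other than $p$ lie together with $p$ in exactly $\lambda_1$ blocks; for every non-flag $(p,B)$ exactly $t$ points of $B$ lie together with $p$ in exactly $\lambda_1$ blocks. Standing assumptions: $v>k\ge2$, $r<b$. Quasi-symmetric with intersection numbers $x<y$: any two distinct blocks share exactly $x$ or $y$ points, and both values occur. -}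

module Defs where

open import Data.Nat using (ℕ; zero; suc; _+_; _<_; _≤_; _≡ᵇ_)
open import Data.Bool using (Bool; true; false; _∧_; not; if_then_else_)
open import Data.Fin using (Fin; zero; suc)
import Data.Fin as Fin
open import Data.Sum using (_⊎_)
open import Data.Product using (Σ; _×_; ∃-syntax)
open import Relation.Binary.PropositionalEquality using (_≡_; _≢_)
open import Relation.Nullary.Decidable using (⌊_⌋)

count : (n : ℕ) → (Fin n → Bool) → ℕ
count zero    f = 0
count (suc n) f = (if f zero then 1 else 0) + count n (λ i → f (suc i))

-- An incidence structure with points Fin v, blocks Fin b (blocks are indexed,
-- so repeated blocks are allowed), incidence given as a Boolean relation.
Incidence : ℕ → ℕ → Set
Incidence v b = Fin v → Fin b → Bool

module _ {v b : ℕ} (I : Incidence v b) where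

  pairCount : Fin v → Fin v → ℕ
  pairCount p q = count b (λ B → I p B ∧ I q B)

  inter : Fin b → Fin b → ℕ
  inter B B' = count v (λ p → I p B ∧ I p B')

  blockSize : Fin b → ℕ
  blockSize B = count v (λ p → I p B)

  replication : Fin v → ℕ
  replication p = count b (λ B → I p B)

  record IsSPBIBD (r k λ₁ λ₂ s t : ℕ) : Set where
    field
      k<v        : k < v
      2≤k        : 2 ≤ k
      r<b        : r < b
      blockSz    : ∀ B → blockSize B ≡ k
      repl       : ∀ p → replication p ≡ r
      pairs      : ∀ p q → p ≢ q → pairCount p q ≡ λ₁ ⊎ pairCount p q ≡ λ₂
      flagCond   : ∀ p B → I p B ≡ true →
                   count v (λ q → not ⌊ q Fin.≟ p ⌋ ∧ I q B ∧ (pairCount p q ≡ᵇ λ₁)) ≡ s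
      nonflagCond : ∀ p B → I p B ≡ false →
                   count v (λ q → I q B ∧ (pairCount p q ≡ᵇ λ₁)) ≡ t

  record IsQuasiSymmetric (x y : ℕ) : Set where
    field
      x<y      : x < y
      twoVals  : ∀ B B' → B ≢ B' → inter B B' ≡ x ⊎ inter B B' ≡ y
      xOccurs  : ∃[ B ] ∃[ B' ] (B ≢ B' × inter B B' ≡ x)
      yOccurs  : ∃[ B ] ∃[ B' ] (B ≢ B' × inter B B' ≡ y)

{-# OPTIONS --safe #-}
-- Summing |B ∩ B′| over all blocks B′ counts each point of B once per block through it,
-- giving rk. The term B′ = B contributes k and every other block contributes 0 or y, so
-- B meets exactly (rk − k)/y other blocks in y points and the remaining b − 1 − (rk − k)/y
-- in none. Both counts are independent of B, and quasi-symmetry makes each positive for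
-- some block, hence for every block.
module Submission where

open import Defs
open import Data.Nat using (ℕ; zero; suc; _+_; _*_; _∸_; _<_; _≡ᵇ_; z<s; s≤s; z≤n; >-nonZero)
open import Data.Nat.Properties
  using (+-identityʳ; +-comm; +-suc; *-zeroʳ; *-identityʳ; ≤-trans; m≤n+m; +-cancelˡ-≡; +-cancelʳ-≡; *-cancelˡ-≡;
         ≡⇒≡ᵇ; ≡ᵇ⇒≡; +-*-semiring)
open import Data.Bool using (Bool; true; false; _∧_; not; if_then_else_)
open import Data.Bool.Properties using (T-≡)
open import Data.Fin using (Fin; zero; suc; punchIn; punchOut)
open import Data.Fin.Properties using (punchInᵢ≢i; punchIn-punchOut)
open import Data.Sum using (_⊎_; inj₁; inj₂)
open import Data.Product using (_×_; ∃-syntax; _,_)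
open import Function using (_∘_; Equivalence)
open import Relation.Binary.PropositionalEquality
  using (_≡_; _≢_; _≗_; refl; sym; trans; cong; cong₂; subst; module ≡-Reasoning)
open import Algebra.Properties.Semiring.Sum +-*-semiring
  using (sum-syntax; sum-cong-≗; ∑-comm; *-distribˡ-sum; *-distribʳ-sum; sum-remove)

[_] : Bool → ℕ
[ b ] = if b then 1 else 0

[∧] : ∀ a c → [ a ∧ c ] ≡ [ a ] * [ c ]
[∧] true  c = sym (+-identityʳ [ c ])
[∧] false c = refl

≡ᵇ-refl : ∀ m → (m ≡ᵇ m) ≡ true
≡ᵇ-refl m = Equivalence.to T-≡ (≡⇒≡ᵇ m m refl)

count≡∑ : ∀ n (f : Fin n → Bool) → count n f ≡ ∑[ i < n ] [ f i ]
count≡∑ zero    f = refl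
count≡∑ (suc n) f = cong ([ f zero ] +_) (count≡∑ n (f ∘ suc))

count-cong : ∀ n {f g : Fin n → Bool} → f ≗ g → count n f ≡ count n g
count-cong zero    f≗g = refl
count-cong (suc n) f≗g = cong₂ _+_ (cong [_] (f≗g zero)) (count-cong n (f≗g ∘ suc))

count+count-not : ∀ n (f : Fin n → Bool) → count n f + count n (not ∘ f) ≡ n
count+count-not zero    f = refl
count+count-not (suc n) f with f zero
... | true  = cong suc (count+count-not n (f ∘ suc))
... | false = trans (+-suc _ _) (cong suc (count+count-not n (f ∘ suc)))

count>0⇒∃ : ∀ n (f : Fin n → Bool) → 0 < count n f → ∃[ i ] f i ≡ true
count>0⇒∃ (suc n) f pos with f zero in eq
... | true  = zero , eq
... | false with count>0⇒∃ n (f ∘ suc) pos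
...   | i , fi = suc i , fi

∃⇒count>0 : ∀ n (f : Fin n → Bool) i → f i ≡ true → 0 < count n f
∃⇒count>0 (suc n) f zero    fi rewrite fi = s≤s z≤n
∃⇒count>0 (suc n) f (suc i) fi = ≤-trans (∃⇒count>0 n (f ∘ suc) i fi) (m≤n+m _ _)

≡*[≡ᵇ] : ∀ {m y} → m ≡ 0 ⊎ m ≡ y → m ≡ y * [ m ≡ᵇ y ]
≡*[≡ᵇ] {y = zero}  (inj₁ refl) = refl
≡*[≡ᵇ] {y = suc y} (inj₁ refl) = sym (*-zeroʳ (suc y))
≡*[≡ᵇ] {y = y}     (inj₂ refl) rewrite ≡ᵇ-refl y = sym (*-identityʳ y)

≡ᵇ0≡not≡ᵇ : ∀ {m y} → 0 < y → m ≡ 0 ⊎ m ≡ y → (m ≡ᵇ 0) ≡ not (m ≡ᵇ y)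
≡ᵇ0≡not≡ᵇ z<s (inj₁ refl) = refl
≡ᵇ0≡not≡ᵇ {y = suc y} z<s (inj₂ refl) rewrite ≡ᵇ-refl y = refl

module _ {n y : ℕ} {f : Fin n → ℕ} (twoValued : ∀ i → f i ≡ 0 ⊎ f i ≡ y) where

  ∑≡*count : ∑[ i < n ] f i ≡ y * count n (λ i → f i ≡ᵇ y)
  ∑≡*count = begin
    ∑[ i < n ] f i                      ≡⟨ sum-cong-≗ (≡*[≡ᵇ] ∘ twoValued) ⟩
    ∑[ i < n ] (y * [ f i ≡ᵇ y ])       ≡⟨ sym (*-distribˡ-sum y (λ i → [ f i ≡ᵇ y ])) ⟩
    y * (∑[ i < n ] [ f i ≡ᵇ y ])       ≡⟨ cong (y *_) (sym (count≡∑ n _)) ⟩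
    y * count n (λ i → f i ≡ᵇ y)        ∎
    where open ≡-Reasoning

  count≡ᵇ0+count≡ᵇ≡n : 0 < y → count n (λ i → f i ≡ᵇ 0) + count n (λ i → f i ≡ᵇ y) ≡ n
  count≡ᵇ0+count≡ᵇ≡n 0<y = begin
    count n (λ i → f i ≡ᵇ 0) + count n (λ i → f i ≡ᵇ y)
      ≡⟨ cong (_+ count n _) (count-cong n (≡ᵇ0≡not≡ᵇ 0<y ∘ twoValued)) ⟩
    count n (λ i → not (f i ≡ᵇ y)) + count n (λ i → f i ≡ᵇ y)
      ≡⟨ +-comm (count n _) _ ⟩
    count n (λ i → f i ≡ᵇ y) + count n (λ i → not (f i ≡ᵇ y))
      ≡⟨ count+count-not n (λ i → f i ≡ᵇ y) ⟩
    n ∎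
    where open ≡-Reasoning

module _ {v b : ℕ} (I : Incidence v b) where

  inter-self : ∀ B → inter I B B ≡ blockSize I B
  inter-self B = count-cong v (λ p → ∧-idem (I p B))
    where
    ∧-idem : ∀ a → a ∧ a ≡ a
    ∧-idem true  = refl
    ∧-idem false = refl

  ∑-inter≡blockSize*r : ∀ {r} → (∀ p → replication I p ≡ r) →
                        ∀ B → ∑[ B′ < b ] inter I B B′ ≡ blockSize I B * r
  ∑-inter≡blockSize*r {r} repl B = begin
    ∑[ B′ < b ] inter I B B′                             ≡⟨ sum-cong-≗ (λ B′ → count≡∑ v (λ p → I p B ∧ I p B′)) ⟩
    ∑[ B′ < b ] ∑[ p < v ] [ I p B ∧ I p B′ ]             ≡⟨ ∑-comm (λ B′ p → [ I p B ∧ I p B′ ]) ⟩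
    ∑[ p < v ] ∑[ B′ < b ] [ I p B ∧ I p B′ ]             ≡⟨ sum-cong-≗ (λ p → sum-cong-≗ (λ B′ → [∧] (I p B) (I p B′))) ⟩
    ∑[ p < v ] ∑[ B′ < b ] ([ I p B ] * [ I p B′ ])       ≡⟨ sum-cong-≗ (λ p → sym (*-distribˡ-sum [ I p B ] (λ B′ → [ I p B′ ]))) ⟩
    ∑[ p < v ] ([ I p B ] * ∑[ B′ < b ] [ I p B′ ])       ≡⟨ sum-cong-≗ (λ p → cong ([ I p B ] *_) (trans (sym (count≡∑ b _)) (repl p))) ⟩
    ∑[ p < v ] ([ I p B ] * r)                           ≡⟨ sym (*-distribʳ-sum r (λ p → [ I p B ])) ⟩
    (∑[ p < v ] [ I p B ]) * r                           ≡⟨ cong (_* r) (sym (count≡∑ v _)) ⟩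
    blockSize I B * r                                    ∎
    where open ≡-Reasoning

module ZeroIntersection {v n r k y : ℕ} (I : Incidence v (suc n))
  (blockSize≡k : ∀ B → blockSize I B ≡ k) (replication≡r : ∀ p → replication I p ≡ r)
  (0<y : 0 < y) (inter≡0⊎y : ∀ B B′ → B ≢ B′ → inter I B B′ ≡ 0 ⊎ inter I B B′ ≡ y) where

  -- The blocks other than B are enumerated as punchIn B j for j : Fin n.
  meeting : ℕ → Fin (suc n) → ℕ
  meeting m B = count n (λ j → inter I B (punchIn B j) ≡ᵇ m)

  inter-others≡0⊎y : ∀ B j → inter I B (punchIn B j) ≡ 0 ⊎ inter I B (punchIn B j) ≡ y
  inter-others≡0⊎y B j = inter≡0⊎y B (punchIn B j) (punchInᵢ≢i B j ∘ sym)

  k+y*meeting≡k*r : ∀ B → k + y * meeting y B ≡ k * r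
  k+y*meeting≡k*r B = begin
    k + y * meeting y B
      ≡⟨ cong₂ _+_ (sym (trans (inter-self I B) (blockSize≡k B))) (sym (∑≡*count (inter-others≡0⊎y B))) ⟩
    inter I B B + ∑[ j < n ] inter I B (punchIn B j)
      ≡⟨ sym (sum-remove (inter I B)) ⟩
    ∑[ B′ < suc n ] inter I B B′
      ≡⟨ ∑-inter≡blockSize*r I replication≡r B ⟩
    blockSize I B * r
      ≡⟨ cong (_* r) (blockSize≡k B) ⟩
    k * r ∎
    where open ≡-Reasoning

  meeting-y-const : ∀ B C → meeting y B ≡ meeting y C
  meeting-y-const B C = *-cancelˡ-≡ _ _ y {{>-nonZero 0<y}}
    (+-cancelˡ-≡ k _ _ (trans (k+y*meeting≡k*r B) (sym (k+y*meeting≡k*r C))))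

  meeting-0-const : ∀ B C → meeting 0 B ≡ meeting 0 C
  meeting-0-const B C = +-cancelʳ-≡ (meeting y B) _ _ (begin
    meeting 0 B + meeting y B  ≡⟨ count≡ᵇ0+count≡ᵇ≡n (inter-others≡0⊎y B) 0<y ⟩
    n                          ≡⟨ sym (count≡ᵇ0+count≡ᵇ≡n (inter-others≡0⊎y C) 0<y) ⟩
    meeting 0 C + meeting y C  ≡⟨ cong (meeting 0 C +_) (sym (meeting-y-const B C)) ⟩
    meeting 0 C + meeting y B  ∎)
    where open ≡-Reasoning

  meeting>0⇒∃ : ∀ {m} B → 0 < meeting m B → ∃[ B′ ] (B′ ≢ B × inter I B B′ ≡ m)
  meeting>0⇒∃ {m} B pos with count>0⇒∃ n _ pos
  ... | j , eq = punchIn B j , punchInᵢ≢i B j , ≡ᵇ⇒≡ _ m (Equivalence.from T-≡ eq)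

  ∃⇒meeting>0 : ∀ {m B B′} → B ≢ B′ → inter I B B′ ≡ m → 0 < meeting m B
  ∃⇒meeting>0 {m} {B} B≢B′ eq = ∃⇒count>0 n _ (punchOut B≢B′)
    (Equivalence.to T-≡ (≡⇒≡ᵇ _ m (trans (cong (inter I B) (punchIn-punchOut B≢B′)) eq)))

  occurs⇒occurs-everywhere : ∀ {m} → (∀ B C → meeting m B ≡ meeting m C) →
    ∃[ C ] ∃[ C′ ] (C ≢ C′ × inter I C C′ ≡ m) → ∀ B → ∃[ B′ ] (B′ ≢ B × inter I B B′ ≡ m)
  occurs⇒occurs-everywhere const (C , C′ , C≢C′ , eq) B =
    meeting>0⇒∃ B (subst (0 <_) (const C B) (∃⇒meeting>0 C≢C′ eq))

lemma4p3 : ∀ {v b : ℕ} (I : Incidence v b) (r k λ₁ t y : ℕ) →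
    IsSPBIBD I r k λ₁ 0 (k ∸ 1) t →
    IsQuasiSymmetric I 0 y →
    0 < y →
    ∀ (B : Fin b) → ∃[ B₁ ] ∃[ B₂ ]
      (B₁ ≢ B × B₂ ≢ B × inter I B B₁ ≡ 0 × inter I B B₂ ≡ y)
lemma4p3 {b = suc n} I r k λ₁ t y spbibd qs 0<y B =
  let B₁ , B₁≢B , disjoint = occurs⇒occurs-everywhere meeting-0-const xOccurs B
      B₂ , B₂≢B , meets    = occurs⇒occurs-everywhere meeting-y-const yOccurs B
  in  B₁ , B₂ , B₁≢B , B₂≢B , disjoint , meets
  where
  open IsSPBIBD spbibd using (blockSz; repl)
  open IsQuasiSymmetric qs using (twoVals; xOccurs; yOccurs)
  open ZeroIntersection I blockSz repl 0<y twoVals
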